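{- No two distinct non-trivial cycles have the same signature. That is, if $(t_1,\dots,t_m)$ and $(t'_1,\dots,t'_m)$ are non-trivial cycles of length $m$ whose signatures satisfy $s_i=s'_i$ for all $i=1,\dots,m$, then $t_i=t'_i$ for all $i$.
   Context: The subprime Fibonacci rule: from positive integers $x,y$ with $s=x+y$, the next term is $s$ if $s$ is prime and $s/p$ if $s$ is composite, where $p$ is the smallest prime factor of $s$. A non-trivial cycle of length $m$ is an $m$-tuple $(t_1,\dots,t_m)$ of positive integers, indices read modulo $m$, such that for every $i$, $t_i$ is obtained from $t_{i-2},t_{i-1}$ by this rule, the $t_i$ are not all equal, and $m$ is the minimal period. Its signature is $(s_1,\dots,s_m)$ where $s_i=(t_{i-2}+t_{i-1})/t_i$ (so $s_i=1$ if $t_{i-2}+t_{i-1}$ is prime, and otherwise $s_i$ is the smallest prime factor of $t_{i-2}+t_{i-1}$). -}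

module Defs where

open import Data.Nat using (ℕ; zero; suc; _+_; _*_; _≤_; _<_)
open import Data.Nat.Divisibility using (_∣_)
open import Data.Nat.Primality using (Prime)
open import Data.Product using (Σ; ∃; _×_; _,_)
open import Data.Sum using (_⊎_)
open import Relation.Nullary using (¬_)
open import Relation.Binary.PropositionalEquality using (_≡_; _≢_)

IsSmallestPrimeFactor : ℕ → ℕ → Set
IsSmallestPrimeFactor p n = Prime p × p ∣ n × (∀ q → Prime q → q ∣ n → p ≤ q)

SubprimeStep : ℕ → ℕ → ℕ → Set
SubprimeStep x y z =
  (Prime (x + y) × z ≡ x + y) ⊎
  (¬ Prime (x + y) × ∃ λ p → IsSmallestPrimeFactor p (x + y) × z * p ≡ x + y)

-- A cycle of length m, represented as an m-periodic sequence t : ℕ → ℕ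
-- (t i plays the role of t_i with indices modulo m).
HasPeriod : (ℕ → ℕ) → ℕ → Set
HasPeriod t k = ∀ i → t (i + k) ≡ t i

IsNontrivialCycle : ℕ → (ℕ → ℕ) → Set
IsNontrivialCycle m t =
  0 < m ×
  HasPeriod t m ×
  (∀ k → 0 < k → HasPeriod t k → m ≤ k) ×
  (∀ i → 0 < t i) ×
  (∀ i → SubprimeStep (t i) (t (suc i)) (t (suc (suc i)))) ×
  (∃ λ i → ∃ λ j → t i ≢ t j)

-- σ is the signature entry at index i+2: σ * t_{i+2} = t_i + t_{i+1}
SignatureAt : (ℕ → ℕ) → ℕ → ℕ → Set
SignatureAt t i σ = σ * t (suc (suc i)) ≡ t i + t (suc i)

{-# OPTIONS --safe #-}
-- If every sum t i + t (i+1) of a cycle were composite, each term would be at most the mean of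
-- the two before it, so a maximal term forces its two predecessors to be maximal too and, going
-- backwards around the cycle, the cycle is constant.  Two cycles with the same signature are
-- proportional: the same backward argument applied to a maximal ratio t′ i / t i shows all
-- ratios equal.  At an index where the sum P is prime the proportional sum P′ has signature
-- entry 1 as well, hence is prime; P divides P′ · t i with 0 < t i < P, so P = P′ and the
-- proportionality factor is 1.
module Submission where

open import Defs
open import Data.Nat using (ℕ; zero; suc; _+_; _*_; _≤_; _<_; z≤n; s≤s; NonZero; >-nonZero; _≟_)
open import Data.Nat.Base using (nonTrivial⇒n>1)
open import Data.Nat.Properties
open import Data.Nat.DivMod using (_%_; _/_; m≡m%n+[m/n]*n; m%n<n)
open import Data.Nat.Divisibility using (_∣_; divides; >⇒∤)
open import Data.Nat.Primality using (Prime; prime⇒irreducible; prime⇒nonTrivial; prime⇒nonZero; euclidsLemma)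
open import Algebra.Properties.CommutativeSemigroup *-commutativeSemigroup using (x∙yz≈y∙xz; xy∙z≈y∙xz; xy∙z≈xz∙y)
open import Data.Product using (∃; ∃₂; _×_; _,_; proj₁; proj₂)
open import Data.Sum using (_⊎_; inj₁; inj₂; reduce)
open import Relation.Nullary using (¬_; contradiction)
open import Relation.Nullary.Decidable using (decidable-stable)
open import Relation.Binary.PropositionalEquality using (_≡_; refl; sym; trans; cong; cong₂; subst; subst₂; module ≡-Reasoning)

prime⇒1< : ∀ {p} → Prime p → 1 < p
prime⇒1< {p} p-prime = nonTrivial⇒n>1 p {{prime⇒nonTrivial p-prime}}

prime∣prime*small⇒≡ : ∀ {p q a} → Prime p → Prime q → p ∣ q * a → 0 < a → a < p → p ≡ q
prime∣prime*small⇒≡ {p} {q} {a} p-prime q-prime p∣qa 0<a a<p with euclidsLemma q a p-prime p∣qa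
... | inj₂ p∣a = contradiction p∣a (>⇒∤ {{>-nonZero 0<a}} a<p)
... | inj₁ p∣q with prime⇒irreducible q-prime p∣q
...   | inj₁ p≡1 = contradiction p≡1 (>⇒≢ (prime⇒1< p-prime))
...   | inj₂ p≡q = p≡q

+-squeeze : ∀ {a b c d} → a ≤ c → b ≤ d → c + d ≡ a + b → c ≡ a × d ≡ b
+-squeeze {a} {b} {c} {d} a≤c b≤d c+d≡a+b =
  ≤-antisym (+-cancelʳ-≤ d c a (≤-trans (≤-reflexive c+d≡a+b) (+-monoʳ-≤ a b≤d))) a≤c ,
  ≤-antisym (+-cancelˡ-≤ c d b (≤-trans (≤-reflexive c+d≡a+b) (+-monoˡ-≤ b a≤c))) b≤d

-- a′ * b ≤ b′ * a says a′ / a ≤ b′ / b.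
ratio-≤-trans : ∀ {a a′ b b′ c c′} → 0 < b → a′ * b ≤ b′ * a → b′ * c ≤ c′ * b → a′ * c ≤ c′ * a
ratio-≤-trans {a} {a′} {b} {b′} {c} {c′} 0<b ab≤ba bc≤cb = *-cancelʳ-≤ _ _ b {{>-nonZero 0<b}} (begin
  a′ * c * b  ≡⟨ xy∙z≈xz∙y a′ c b ⟩
  a′ * b * c  ≤⟨ *-monoˡ-≤ c ab≤ba ⟩
  b′ * a * c  ≡⟨ xy∙z≈xz∙y b′ a c ⟩
  b′ * c * a  ≤⟨ *-monoˡ-≤ a bc≤cb ⟩
  c′ * b * a  ≡⟨ xy∙z≈xz∙y c′ b a ⟩
  c′ * a * b  ∎)
  where open ≤-Reasoning

cross-multiply : ∀ {A B a a′ c c′} → 0 < A → A * a ≡ B * a′ → A * c ≡ B * c′ → c * a′ ≡ c′ * a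
cross-multiply {A} {B} {a} {a′} {c} {c′} 0<A Aa≡Ba′ Ac≡Bc′ = *-cancelˡ-≡ _ _ A {{>-nonZero 0<A}} (begin
  A * (c * a′)  ≡⟨ sym (*-assoc A c a′) ⟩
  A * c * a′    ≡⟨ cong (_* a′) Ac≡Bc′ ⟩
  B * c′ * a′   ≡⟨ xy∙z≈y∙xz B c′ a′ ⟩
  c′ * (B * a′) ≡⟨ cong (c′ *_) (sym Aa≡Ba′) ⟩
  c′ * (A * a)  ≡⟨ x∙yz≈y∙xz c′ A a ⟩
  A * (c′ * a)  ∎)
  where open ≡-Reasoning

proportional-prime-sums⇒≡ : ∀ {A B a b a′ b′} → 0 < A → 0 < a → 0 < b →
  Prime (a + b) → Prime (a′ + b′) → A * a ≡ B * a′ → A * b ≡ B * b′ → A ≡ B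
proportional-prime-sums⇒≡ {A} {B} {a} {b} {a′} {b′} 0<A 0<a 0<b P-prime P′-prime Aa≡Ba′ Ab≡Bb′ =
  *-cancelʳ-≡ A B (a + b) {{prime⇒nonZero P-prime}} (trans AP≡BP′ (cong (B *_) (sym P≡P′)))
  where
  AP≡BP′ : A * (a + b) ≡ B * (a′ + b′)
  AP≡BP′ = begin
    A * (a + b)        ≡⟨ *-distribˡ-+ A a b ⟩
    A * a + A * b      ≡⟨ cong₂ _+_ Aa≡Ba′ Ab≡Bb′ ⟩
    B * a′ + B * b′    ≡⟨ sym (*-distribˡ-+ B a′ b′) ⟩
    B * (a′ + b′)      ∎
    where open ≡-Reasoning
  P∣P′a : a + b ∣ (a′ + b′) * a
  P∣P′a = divides a′ (trans (sym (cross-multiply {A} {B} 0<A Aa≡Ba′ AP≡BP′)) (*-comm (a + b) a′))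
  P≡P′ : a + b ≡ a′ + b′
  P≡P′ = prime∣prime*small⇒≡ P-prime P′-prime P∣P′a 0<a (m<m+n a 0<b)

+-closed-* : ∀ {E : ℕ → Set} {m} → (∀ x → E x → E (x + m)) → ∀ N x → E x → E (x + N * m)
+-closed-* {E} E-+m zero x e = subst E (sym (+-identityʳ x)) e
+-closed-* {E} {m} E-+m (suc N) x e = subst E x+N*m+m≡x+[m+N*m] (E-+m _ (+-closed-* E-+m N x e))
  where
  x+N*m+m≡x+[m+N*m] : x + N * m + m ≡ x + (m + N * m)
  x+N*m+m≡x+[m+N*m] = trans (+-assoc x (N * m) m) (cong (x +_) (+-comm (N * m) m))

HasPeriod-* : ∀ {t m} → HasPeriod t m → ∀ N → HasPeriod t (N * m)
HasPeriod-* {t} per N i = +-closed-* {λ x → t x ≡ t i} (λ x tx≡ti → trans (per x) tx≡ti) N i refl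

HasPeriod⇒≡% : ∀ {t m} .{{_ : NonZero m}} → HasPeriod t m → ∀ j → t j ≡ t (j % m)
HasPeriod⇒≡% {t} {m} per j = trans (cong t (m≡m%n+[m/n]*n j m)) (HasPeriod-* per (j / m) (j % m))

backward-closed⇒everywhere : ∀ {E : ℕ → Set} {m} → 0 < m →
  (∀ x → E x → E (x + m)) →
  (∀ x → E (suc (suc x)) → E x × E (suc x)) →
  ∀ {k} → E k → ∀ j → E j
backward-closed⇒everywhere {E} {m} 0<m E-+m E-back {k} e j =
  proj₁ (E-back j (down d (suc j) (subst E (sym 2+j+d≡k+N*m) (+-closed-* E-+m N k e))))
  where
  down : ∀ d x → E (suc x + d) → E (suc x)
  down zero x e = subst E (+-identityʳ (suc x)) e
  down (suc d) x e = proj₂ (E-back x (down d (suc x) (subst E (cong suc (+-suc x d)) e)))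
  N = suc (suc j)
  2+j≤k+N*m : suc (suc j) ≤ k + N * m
  2+j≤k+N*m = ≤-trans (m≤m*n N m {{>-nonZero 0<m}}) (m≤n+m (N * m) k)
  d = proj₁ (m≤n⇒∃[o]m+o≡n 2+j≤k+N*m)
  2+j+d≡k+N*m = proj₂ (m≤n⇒∃[o]m+o≡n 2+j≤k+N*m)

module _ {R : ℕ → ℕ → Set} (R-total : ∀ i j → R i j ⊎ R j i)
         (R-trans : ∀ {i j k} → R i j → R j k → R i k) where

  argmax-≤ : ∀ n → ∃ λ k → ∀ i → i ≤ n → R i k
  argmax-≤ zero = 0 , λ { .zero z≤n → reduce (R-total 0 0) }
  argmax-≤ (suc n) with argmax-≤ n
  ... | k , max with R-total k (suc n)
  ...   | inj₁ k≤n+1 = suc n , λ i i≤n+1 → below (m≤n⇒m<n∨m≡n i≤n+1)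
    where
    below : ∀ {i} → i < suc n ⊎ i ≡ suc n → R i (suc n)
    below {i} (inj₁ (s≤s i≤n)) = R-trans (max i i≤n) k≤n+1
    below (inj₂ refl) = reduce (R-total (suc n) (suc n))
  ...   | inj₂ n+1≤k = k , λ i i≤n+1 → below (m≤n⇒m<n∨m≡n i≤n+1)
    where
    below : ∀ {i} → i < suc n ⊎ i ≡ suc n → R i k
    below {i} (inj₁ (s≤s i≤n)) = max i i≤n
    below (inj₂ refl) = n+1≤k

  argmax-% : ∀ m .{{_ : NonZero m}} → (∀ i j → R (i % m) j → R i j) → ∃ λ k → ∀ i → R i k
  argmax-% m@(suc n) R-% with argmax-≤ n
  ... | k , max = k , λ i → R-% i k (max (i % m) (≤-pred (m%n<n i m)))

SubprimeStep-composite : ∀ {x y z} → SubprimeStep x y z → ¬ Prime (x + y) → 2 * z ≤ x + y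
SubprimeStep-composite (inj₁ (sum-prime , _)) composite = contradiction sum-prime composite
SubprimeStep-composite {x} {y} {z} (inj₂ (_ , p , (p-prime , _) , z*p≡x+y)) _ = begin
  2 * z  ≤⟨ *-monoˡ-≤ z (prime⇒1< p-prime) ⟩
  p * z  ≡⟨ *-comm p z ⟩
  z * p  ≡⟨ z*p≡x+y ⟩
  x + y  ∎
  where open ≤-Reasoning

SubprimeStep-signature : ∀ {x y z σ} → SubprimeStep x y z → 0 < z → σ * z ≡ x + y →
  (Prime (x + y) × σ ≡ 1) ⊎ (¬ Prime (x + y) × 1 < σ)
SubprimeStep-signature {z = z} {σ} (inj₁ (sum-prime , z≡x+y)) 0<z σz≡x+y =
  inj₁ (sum-prime , *-cancelʳ-≡ σ 1 z {{>-nonZero 0<z}} (trans σz≡x+y (trans (sym z≡x+y) (sym (*-identityˡ z)))))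
SubprimeStep-signature {z = z} {σ} (inj₂ (composite , p , (p-prime , _) , z*p≡x+y)) 0<z σz≡x+y =
  inj₂ (composite , subst (1 <_) (sym σ≡p) (prime⇒1< p-prime))
  where
  σ≡p : σ ≡ p
  σ≡p = *-cancelˡ-≡ σ p z {{>-nonZero 0<z}} (trans (*-comm z σ) (trans σz≡x+y (sym z*p≡x+y)))

all-sums-composite⇒constant : ∀ {m t} → 0 < m → HasPeriod t m →
  (∀ i → SubprimeStep (t i) (t (suc i)) (t (suc (suc i)))) →
  (∀ i → ¬ Prime (t i + t (suc i))) →
  ∀ i j → t i ≡ t j
all-sums-composite⇒constant {m} {t} 0<m per step composite i j =
  trans (sym (maximal i)) (maximal j)
  where
  instance _ = >-nonZero 0<m
  max = argmax-% (λ i j → ≤-total (t i) (t j)) ≤-trans m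
                 (λ i j → subst (_≤ t j) (sym (HasPeriod⇒≡% per i)))
  M = t (proj₁ max)
  t≤M : ∀ i → t i ≤ M
  t≤M = proj₂ max
  back : ∀ x → M ≡ t (suc (suc x)) → M ≡ t x × M ≡ t (suc x)
  back x M≡t[2+x] = +-squeeze (t≤M x) (t≤M (suc x))
    (≤-antisym M+M≤t+t (+-mono-≤ (t≤M x) (t≤M (suc x))))
    where
    M+M≤t+t : M + M ≤ t x + t (suc x)
    M+M≤t+t = subst (_≤ t x + t (suc x)) (trans (cong (2 *_) (sym M≡t[2+x])) (cong (M +_) (+-identityʳ M)))
                    (SubprimeStep-composite {t x} {t (suc x)} (step x) (composite x))
  maximal : ∀ i → M ≡ t i
  maximal = backward-closed⇒everywhere 0<m (λ x M≡tx → trans M≡tx (sym (per x))) back refl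

same-signature⇒proportional : ∀ {m t t′} → 0 < m → HasPeriod t m → HasPeriod t′ m →
  (∀ i → 0 < t i) → (∀ i → 0 < t′ i) →
  (∀ i → ∃ λ σ → SignatureAt t i σ × SignatureAt t′ i σ) →
  ∃₂ λ A B → 0 < A × (∀ x → A * t x ≡ B * t′ x)
same-signature⇒proportional {m} {t} {t′} 0<m per per′ pos pos′ sig =
  A , B , pos′ k , backward-closed⇒everywhere 0<m A∼B-+m back (*-comm A B)
  where
  instance _ = >-nonZero 0<m
  max = argmax-% {λ i j → t′ i * t j ≤ t′ j * t i}
                 (λ i j → ≤-total _ _) (λ {i} {j} {k} → ratio-≤-trans {t i} {t′ i} {t j} {t′ j} {t k} {t′ k} (pos j)) m
                 (λ i j → subst₂ (λ a b → a * t j ≤ t′ j * b)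
                                 (sym (HasPeriod⇒≡% per′ i)) (sym (HasPeriod⇒≡% per i)))
  k = proj₁ max
  A = t′ k
  B = t k
  Bt′≤At : ∀ x → B * t′ x ≤ A * t x
  Bt′≤At x = subst (_≤ A * t x) (*-comm (t′ x) B) (proj₂ max x)
  A∼B-+m : ∀ x → A * t x ≡ B * t′ x → A * t (x + m) ≡ B * t′ (x + m)
  A∼B-+m x A∼B = trans (cong (A *_) (per x)) (trans A∼B (cong (B *_) (sym (per′ x))))
  back : ∀ x → A * t (suc (suc x)) ≡ B * t′ (suc (suc x)) →
         A * t x ≡ B * t′ x × A * t (suc x) ≡ B * t′ (suc x)
  back x A∼B = +-squeeze (Bt′≤At x) (Bt′≤At (suc x)) (begin
    A * t x + A * t (suc x)     ≡⟨ sym (*-distribˡ-+ A (t x) (t (suc x))) ⟩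
    A * (t x + t (suc x))       ≡⟨ cong (A *_) (sym sig-t) ⟩
    A * (σ * t (suc (suc x)))   ≡⟨ x∙yz≈y∙xz A σ _ ⟩
    σ * (A * t (suc (suc x)))   ≡⟨ cong (σ *_) A∼B ⟩
    σ * (B * t′ (suc (suc x)))  ≡⟨ x∙yz≈y∙xz σ B _ ⟩
    B * (σ * t′ (suc (suc x)))  ≡⟨ cong (B *_) sig-t′ ⟩
    B * (t′ x + t′ (suc x))     ≡⟨ *-distribˡ-+ B (t′ x) (t′ (suc x)) ⟩
    B * t′ x + B * t′ (suc x)   ∎)
    where
    open ≡-Reasoning
    σ = proj₁ (sig x)
    sig-t = proj₁ (proj₂ (sig x))
    sig-t′ = proj₂ (proj₂ (sig x))

same-signature∧prime-sum⇒≡ : ∀ {m t t′} → IsNontrivialCycle m t → IsNontrivialCycle m t′ →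
  (∀ i → ∃ λ σ → SignatureAt t i σ × SignatureAt t′ i σ) →
  ∀ {i₀} → Prime (t i₀ + t (suc i₀)) → ∀ i → t i ≡ t′ i
same-signature∧prime-sum⇒≡ {t = t} {t′} (0<m , per , _ , pos , step , _) (_ , per′ , _ , pos′ , step′ , _)
                            sig {i₀} P-prime
  with same-signature⇒proportional 0<m per per′ pos pos′ sig
... | A , B , 0<A , A∼B = λ i →
  *-cancelˡ-≡ (t i) (t′ i) A {{>-nonZero 0<A}} (trans (A∼B i) (cong (_* t′ i) (sym A≡B)))
  where
  σ = proj₁ (sig i₀)
  σ≡1 : σ ≡ 1
  σ≡1 with SubprimeStep-signature {t i₀} {t (suc i₀)} (step i₀) (pos _) (proj₁ (proj₂ (sig i₀)))
  ... | inj₁ (_ , σ≡1) = σ≡1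
  ... | inj₂ (composite , _) = contradiction P-prime composite
  P′-prime : Prime (t′ i₀ + t′ (suc i₀))
  P′-prime with SubprimeStep-signature {t′ i₀} {t′ (suc i₀)} (step′ i₀) (pos′ _) (proj₂ (proj₂ (sig i₀)))
  ... | inj₁ (sum-prime , _) = sum-prime
  ... | inj₂ (_ , 1<σ) = contradiction σ≡1 (>⇒≢ 1<σ)
  A≡B : A ≡ B
  A≡B = proportional-prime-sums⇒≡ 0<A (pos i₀) (pos (suc i₀)) P-prime P′-prime (A∼B i₀) (A∼B (suc i₀))

theorem5 : (m : ℕ) (t t′ : ℕ → ℕ) →
    IsNontrivialCycle m t → IsNontrivialCycle m t′ →
    (∀ i → ∃ λ σ → SignatureAt t i σ × SignatureAt t′ i σ) →
    ∀ i → t i ≡ t′ i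
theorem5 m t t′ cycle@(0<m , per , _ , _ , step , i₁ , i₂ , tᵢ₁≢tᵢ₂) cycle′ sig i =
  -- a prime sum is only shown to exist up to double negation; equality in ℕ is stable
  decidable-stable (t i ≟ t′ i) λ tᵢ≢t′ᵢ →
    tᵢ₁≢tᵢ₂ (all-sums-composite⇒constant 0<m per step
      (λ i₀ P-prime → tᵢ≢t′ᵢ (same-signature∧prime-sum⇒≡ cycle cycle′ sig P-prime i)) i₁ i₂)
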